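{- Let $m\ge2$ and $n\ge 2$ be integers, and let $k$ be an integer with $1\le k\le n^2-3n+2$, written $k=(n-1)q+r$ with $q\ge0$ and $1\le r\le n-1$. Let $\mathbb{A}_0$ and $\mathbb{A}_k$ be the tensors of order $m$ and dimension $n$ defined in the context. Then for every integer $t\in\{1,\ldots,k\}$ and every $j\in\{1,\ldots,n-2\}\cup\{n\}$, $S_t(\mathbb{A}_k,j)=S_t(\mathbb{A}_0,j)$.
   Context: A tensor of order $m$ and dimension $n$ is an array $(a_{i_1\cdots i_m})$ with indices in $[n]=\{1,\ldots,n\}$. General product: if $\mathbb{A}$ has order $m\ge2$ and $\mathbb{B}$ has order $p\ge1$, then $\mathbb{A}\mathbb{B}$ is the tensor of order $(m-1)(p-1)+1$ with entries $d_{i\alpha_1\cdots\alpha_{m-1}}=\sum_{i_2,\ldots,i_m=1}^n a_{ii_2\cdots i_m}b_{i_2\alpha_1}\cdots b_{i_m\alpha_{m-1}}$ ($\alpha_l\in[n]^{p-1}$); it is associative, and $\mathbb{A}^{t+1}=\mathbb{A}\mathbb{A}^t$. The majorization matrix of a tensor $\mathbb{B}$ is $(M(\mathbb{B}))_{ij}=b_{ij\cdots j}$. For a nonnegative tensor $\mathbb{A}$, $j\in[n]$ and $t\ge1$, $S_t(\mathbb{A},j)=\{u\in[n]: (M(\mathbb{A}^t))_{uj}>0\}$. $|a|_n$ is the unique element of $\{1,\ldots,n\}$ congruent to $a$ mod $n$. $M_1$ is the $n\times n$ $0$-$1$ matrix with $(M_1)_{1,n-1}=(M_1)_{1,n}=1$,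 $(M_1)_{i+1,i}=1$ ($1\le i\le n-1$), other entries $0$. $\mathbb{A}_0=(a_{i_1\cdots i_m})$ has $a_{ij\cdots j}=(M_1)_{ij}$ and $a_{ii_2\cdots i_m}=0$ whenever $i_2,\ldots,i_m$ are not all equal. $\mathbb{A}_k=(a^{(k)}_{i_1\cdots i_m})$ has $a^{(k)}_{ij\cdots j}=(M_1)_{ij}$; $a^{(k)}_{ii_2\cdots i_m}=1$ if $i\notin\{|r-q|_n,|r-q+1|_n,\ldots,|r+1|_n\}$ and the set of distinct values among $i_2,\ldots,i_m$ equals $\{|r-q-1|_n,|r|_n\}$; all other entries $0$. -}

module Defs where

open import Data.Nat as ℕ using (ℕ; zero; suc; _+_; _*_; _∸_; _^_; _≡ᵇ_)
open import Data.Bool using (Bool; true; false; _∧_; _∨_; not; if_then_else_)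
open import Data.Fin using (Fin; toℕ)
open import Data.Fin.Properties using (_≟_)
open import Data.Vec using (Vec; []; _∷_; take; drop)
open import Data.List using (List; map; allFin; upTo)
open import Data.Bool.ListAction renaming (any to anyL)
open import Data.Nat.ListAction using (sum)
open import Data.Integer as ℤ using (ℤ; +_; _%ℕ_)
open import Relation.Nullary.Decidable using (⌊_⌋)

-- Tensors of order m and dimension n, with nonnegative (natural number)
-- entries.  Index i ∈ Fin n stands for the paper's index toℕ i + 1.

Tensor : ℕ → ℕ → Set
Tensor n m = Vec (Fin n) m → ℕ

val : ∀ {n} → Fin n → ℕ
val i = suc (toℕ i)

sumV : (n k : ℕ) → (Vec (Fin n) k → ℕ) → ℕ
sumV n zero    f = f []
sumV n (suc k) f = sum (map (λ i → sumV n k (λ v → f (i ∷ v))) (allFin n))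

chunks : ∀ {X : Set} (a b : ℕ) → Vec X (a * b) → Vec (Vec X b) a
chunks zero    b []  = []
chunks (suc a) b xs = take b xs ∷ chunks a b (drop b xs)

prodPairs : ∀ {n a b} → Tensor n (suc b) → Vec (Fin n) a → Vec (Vec (Fin n) b) a → ℕ
prodPairs B []       []       = 1
prodPairs B (j ∷ js) (α ∷ αs) = B (j ∷ α) * prodPairs B js αs

-- General product: A of order a+1, B of order b+1, result of order a*b+1
--   d_{i α_1 … α_a} = Σ_{i_2..i_{a+1}} a_{i i_2 … } b_{i_2 α_1} ⋯ b_{i_{a+1} α_a}
_⊙_ : ∀ {n a b} → Tensor n (suc a) → Tensor n (suc b) → Tensor n (suc (a * b))
_⊙_ {n} {a} {b} A B (i ∷ rest) =
  sumV n a (λ js → A (i ∷ js) * prodPairs B js (chunks a b rest))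

-- unit (identity matrix, order 2); A ⊙ I = A, used only as the base of powers
unitT : ∀ {n} → Tensor n 2
unitT (i ∷ j ∷ []) = if ⌊ i ≟ j ⌋ then 1 else 0

-- powers A^t with A^{t+1} = A A^t (A^0 = I, so A^1 = A ⊙ I = A entrywise)
powS : ∀ {n a} → Tensor n (suc a) → (t : ℕ) → Tensor n (suc (a ^ t))
powS A zero    = unitT
powS A (suc t) = A ⊙ powS A t

-- for a tensor of order m (m ≥ 1 required for powers; order 0 gives 0)
pow : ∀ {n m} → Tensor n m → (t : ℕ) → Tensor n (suc (ℕ.pred m ^ t))
pow {m = zero}  A t = λ _ → 0
pow {m = suc a} A t = powS A t

replicateV : ∀ {X : Set} (k : ℕ) → X → Vec X k
replicateV zero    x = []
replicateV (suc k) x = x ∷ replicateV k x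

Maj : ∀ {n p} → Tensor n (suc p) → Fin n → Fin n → ℕ
Maj {p = p} B i j = B (i ∷ replicateV p j)

-- u ∈ S_t(A, j)  ⇔  (M(A^t))_{uj} > 0
InS : ∀ {n m} → ℕ → Tensor n m → Fin n → Fin n → Set
InS t A j u = 0 ℕ.< Maj (pow A t) u j

-- |a|_n : the unique element of {1..n} congruent to a mod n (n ≥ 1)

absN : ℕ → ℤ → ℕ
absN zero    a = 0
absN (suc k) a = suc ((a ℤ.- + 1) %ℕ suc k)

M1 : ∀ {n} → Fin n → Fin n → ℕ
M1 {n} i j =
  if ((val i ≡ᵇ 1) ∧ ((val j ≡ᵇ (n ∸ 1)) ∨ (val j ≡ᵇ n))) ∨ (val i ≡ᵇ suc (val j))
  then 1 else 0

allV : ∀ {X : Set} {k} → (X → Bool) → Vec X k → Bool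
allV P []       = true
allV P (x ∷ xs) = P x ∧ allV P xs

anyV : ∀ {X : Set} {k} → (X → Bool) → Vec X k → Bool
anyV P []       = false
anyV P (x ∷ xs) = P x ∨ anyV P xs

A0entry : ∀ {n k} → Fin n → Vec (Fin n) k → ℕ
A0entry i []       = 0
A0entry i (j ∷ js) = if allV (λ x → ⌊ x ≟ j ⌋) js then M1 i j else 0

A0 : (n m : ℕ) → Tensor n m
A0 n zero    []       = 0
A0 n (suc m) (i ∷ is) = A0entry i is

inRange : (n q r : ℕ) → ℕ → Bool
inRange n q r v =
  anyL (λ s → v ≡ᵇ absN n (+ r ℤ.- + q ℤ.+ + s)) (upTo (q + 2))

Akentry : ∀ {n k} → (q r : ℕ) → Fin n → Vec (Fin n) k → ℕ
Akentry         q r i []       = 0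
Akentry {n} {suc k} q r i (j ∷ js) =
  if allV (λ x → ⌊ x ≟ j ⌋) js then M1 i j
  else (if not (inRange n q r (val i))
           ∧ allV (λ x → (val x ≡ᵇ a) ∨ (val x ≡ᵇ b)) (j ∷ js)
           ∧ anyV (λ x → val x ≡ᵇ a) (j ∷ js)
           ∧ anyV (λ x → val x ≡ᵇ b) (j ∷ js)
        then 1 else 0)
  where
  a = absN n (+ r ℤ.- + q ℤ.- + 1)
  b = absN n (+ r)

Ak : (n m q r : ℕ) → Tensor n m
Ak n zero    q r []       = 0
Ak n (suc m) q r (i ∷ is) = Akentry q r i is

module Submission where

-- Both sets are identified with the set of vertices reachable from j by walks of length t
-- in the digraph D(M₁), the n-cycle 1 → 2 → ⋯ → n → 1 with the extra arc n-1 → 1.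
--  * For any tensor A, (M(A^{t+1}))_{uj} > 0 iff some entry a_{u v₁⋯v_{m-1}} > 0 has all
--    v_l ∈ S_t(A, j) (maj-pow-suc).  Hence S_t(A, j) agrees with any family R t that starts
--    at {j}, is closed under this recursion and is generated by diagonal entries
--    a_{u v⋯v} (support-of-powers).
--  * Walks in D(M₁) are described arithmetically: from a start of position J < n-1, a walk
--    of length t using s shortcuts ends at J + t + s (mod n) and exists iff s = 0 or
--    s(n-1) < t + J (Reach, with reach-zero and reach-suc⇔).
--  * The diagonal entries of 𝔸₀ and 𝔸_k are those of M₁, and 𝔸₀ has no others, so Reach
--    fits 𝔸₀.  The other positive entries of 𝔸_k lead from |r-q-1|_n and |r|_n to vertices
--    outside {|r-q|_n, …, |r+1|_n}; comparing the shortcut counts of the two walks shows that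
--    before time k such vertices are reachable anyway (bridge), so Reach also fits 𝔸_k.
-- The theorem follows after writing n = q + e + 3, which the bound on k permits.

open import Defs
open import Data.Nat using (ℕ; zero; suc; _+_; _*_; _∸_; _^_; _≤_; _<_; z≤n; s≤s; _%_; _/_; _<?_; _≤?_; _≡ᵇ_)
open import Data.Nat.Properties hiding (_≟_)
open import Data.Nat.DivMod
open import Data.Nat.ListAction using (sum)
open import Data.Nat.Tactic.RingSolver using (solve-∀)
open import Data.Integer as ℤ using (ℤ; +_; -[1+_]; _%ℕ_; _/ℕ_)
import Data.Integer.Properties as ℤP
import Data.Integer.DivMod as ℤDM
import Data.Integer.Tactic.RingSolver as ZSolver
open import Data.Fin using (Fin; toℕ; fromℕ; inject₁) renaming (zero to fzero; suc to fsuc)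
open import Data.Fin.Properties using (_≟_; toℕ-injective; toℕ<n; toℕ-fromℕ; toℕ-inject₁)
open import Data.Vec using (Vec; []; _∷_; take; drop)
open import Data.Vec.Relation.Unary.All as All using (All; []; _∷_)
open import Data.List using (List; []; _∷_; map; allFin)
open import Data.List.Membership.Propositional using (_∈_; lose)
open import Data.List.Membership.Propositional.Properties using (∈-allFin; ∈-upTo⁺)
open import Data.List.Relation.Unary.Any using (here; there)
open import Data.List.Relation.Unary.Any.Properties using (any⁺)
open import Data.Bool using (Bool; true; false; T; not; _∧_; _∨_; if_then_else_)
open import Data.Bool.Properties using (T-∧; T-∨; T-not-≡)
open import Data.Product as Product using (∃-syntax; _×_; _,_; proj₁; proj₂)
open import Data.Sum as Sum using (_⊎_; inj₁; inj₂)
open import Data.Empty using (⊥-elim)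
open import Function using (_∘_)
open import Function.Bundles using (_⇔_; mk⇔; Equivalence)
open import Function.Construct.Composition using (_⇔-∘_)
open import Function.Construct.Symmetry using (⇔-sym)
open import Relation.Binary.PropositionalEquality
open import Relation.Nullary using (yes; no; ¬_)
open import Relation.Nullary.Decidable using (⌊_⌋)

open Equivalence using (to; from)

sum-pos⇒ : ∀ {X : Set} (g : X → ℕ) (xs : List X) → 0 < sum (map g xs) → ∃[ x ] 0 < g x
sum-pos⇒ g (x ∷ xs) pos with g x in gx≡
... | zero  = sum-pos⇒ g xs pos
... | suc _ = x , subst (0 <_) (sym gx≡) (s≤s z≤n)

sum-pos⇐ : ∀ {X : Set} (g : X → ℕ) {x : X} (xs : List X) → x ∈ xs → 0 < g x → 0 < sum (map g xs)
sum-pos⇐ g (y ∷ xs) (here refl) pos = <-≤-trans pos (m≤m+n (g y) _)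
sum-pos⇐ g (y ∷ xs) (there x∈) pos = <-≤-trans (sum-pos⇐ g xs x∈ pos) (m≤n+m _ (g y))

sumV-pos⇒ : ∀ n k (f : Vec (Fin n) k → ℕ) → 0 < sumV n k f → ∃[ v ] 0 < f v
sumV-pos⇒ n zero    f pos = [] , pos
sumV-pos⇒ n (suc k) f pos with sum-pos⇒ (λ i → sumV n k (λ v → f (i ∷ v))) (allFin n) pos
... | i , posᵢ with sumV-pos⇒ n k (λ v → f (i ∷ v)) posᵢ
...   | v , posᵥ = i ∷ v , posᵥ

sumV-pos⇐ : ∀ n k (f : Vec (Fin n) k → ℕ) (v : Vec (Fin n) k) → 0 < f v → 0 < sumV n k f
sumV-pos⇐ n zero    f []      pos = pos
sumV-pos⇐ n (suc k) f (i ∷ v) pos =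
  sum-pos⇐ (λ i → sumV n k (λ v → f (i ∷ v))) (allFin n) (∈-allFin i) (sumV-pos⇐ n k (λ v → f (i ∷ v)) v pos)

*-pos⇔ : ∀ {x y} → 0 < x * y ⇔ (0 < x × 0 < y)
*-pos⇔ = mk⇔ split join
  where
  split : ∀ {x y} → 0 < x * y → 0 < x × 0 < y
  split {suc x} {suc y} _ = s≤s z≤n , s≤s z≤n
  split {suc x} {zero}  pos with () ← subst (0 <_) (*-zeroʳ x) pos
  join : ∀ {x y} → 0 < x × 0 < y → 0 < x * y
  join {suc x} {suc y} _ = s≤s z≤n

take-replicate : ∀ {X : Set} b c (x : X) → take b {c} (replicateV (b + c) x) ≡ replicateV b x
take-replicate zero    c x = refl
take-replicate (suc b) c x = cong (x ∷_) (take-replicate b c x)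

drop-replicate : ∀ {X : Set} b c (x : X) → drop b {c} (replicateV (b + c) x) ≡ replicateV c x
drop-replicate zero    c x = refl
drop-replicate (suc b) c x = drop-replicate b c x

chunks-replicate : ∀ {X : Set} a b (x : X) → chunks a b (replicateV (a * b) x) ≡ replicateV a (replicateV b x)
chunks-replicate zero    b x = refl
chunks-replicate (suc a) b x
  rewrite take-replicate b (a * b) x | drop-replicate b (a * b) x = cong (replicateV b x ∷_) (chunks-replicate a b x)

All-replicate : ∀ {X : Set} {P : X → Set} k {x} → P x → All P (replicateV k x)
All-replicate zero    px = []
All-replicate (suc k) px = px ∷ All-replicate k px

prodPairs-pos⇔ : ∀ {n a b} (B : Tensor n (suc b)) (j : Fin n) (vs : Vec (Fin n) a) →
  0 < prodPairs B vs (replicateV a (replicateV b j)) ⇔ All (λ v → 0 < Maj B v j) vs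
prodPairs-pos⇔ B j vs = mk⇔ (split vs) (join vs)
  where
  split : ∀ {a} (vs : Vec _ a) → 0 < prodPairs B vs (replicateV a (replicateV _ j)) → All (λ v → 0 < Maj B v j) vs
  split []       _   = []
  split (v ∷ vs) pos = proj₁ (to *-pos⇔ pos) ∷ split vs (proj₂ (to (*-pos⇔ {B (v ∷ _)}) pos))
  join : ∀ {a} (vs : Vec _ a) → All (λ v → 0 < Maj B v j) vs → 0 < prodPairs B vs (replicateV a (replicateV _ j))
  join []       []         = s≤s z≤n
  join (v ∷ vs) (pv ∷ pvs) = from *-pos⇔ (pv , join vs pvs)

maj-pow-zero : ∀ {n a} (A : Tensor n (suc a)) (u j : Fin n) → 0 < Maj (powS A 0) u j ⇔ u ≡ j
maj-pow-zero A u j = mk⇔ pos⇒≡ ≡⇒pos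
  where
  pos⇒≡ : 0 < Maj (powS A 0) u j → u ≡ j
  pos⇒≡ pos with u ≟ j
  ... | yes u≡j = u≡j
  ... | no  _   with () ← pos
  ≡⇒pos : u ≡ j → 0 < Maj (powS A 0) u j
  ≡⇒pos refl with u ≟ u
  ... | yes _   = s≤s z≤n
  ... | no  u≢u = ⊥-elim (u≢u refl)

-- The recursion S_{t+1}(A, j) = { u : a_{u v₁⋯v_a} > 0 for some v₁, …, v_a ∈ S_t(A, j) },
-- read off from (M(A·A^t))_{uj} = Σ_{vs} a_{u vs} ∏_l (M(A^t))_{v_l j}.
maj-pow-suc : ∀ {n a} (A : Tensor n (suc a)) t (u j : Fin n) →
  0 < Maj (powS A (suc t)) u j ⇔ (∃[ vs ] 0 < A (u ∷ vs) × All (λ v → 0 < Maj (powS A t) v j) vs)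
maj-pow-suc {n} {a} A t u j = mk⇔ split join
  where
  term : Vec (Fin n) a → ℕ
  term vs = A (u ∷ vs) * prodPairs (powS A t) vs (replicateV a (replicateV (a ^ t) j))
  entry≡sum : Maj (powS A (suc t)) u j ≡ sumV n a term
  entry≡sum = cong (λ blocks → sumV n a (λ vs → A (u ∷ vs) * prodPairs (powS A t) vs blocks))
                   (chunks-replicate a (a ^ t) j)
  split : 0 < Maj (powS A (suc t)) u j → ∃[ vs ] 0 < A (u ∷ vs) × All (λ v → 0 < Maj (powS A t) v j) vs
  split pos with sumV-pos⇒ n a term (subst (0 <_) entry≡sum pos)
  ... | vs , posᵥ = vs , proj₁ (to *-pos⇔ posᵥ) , to (prodPairs-pos⇔ (powS A t) j vs) (proj₂ (to (*-pos⇔ {A (u ∷ vs)}) posᵥ))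
  join : (∃[ vs ] 0 < A (u ∷ vs) × All (λ v → 0 < Maj (powS A t) v j) vs) → 0 < Maj (powS A (suc t)) u j
  join (vs , posA , posS) = subst (0 <_) (sym entry≡sum)
    (sumV-pos⇐ n a term vs (from *-pos⇔ (posA , from (prodPairs-pos⇔ (powS A t) j vs) posS)))

support-of-powers : ∀ {n a} (A : Tensor n (suc a)) (j : Fin n) (R : ℕ → Fin n → Set) (K : ℕ) →
  (∀ u → R 0 u ⇔ u ≡ j) →
  (∀ t u vs → t < K → 0 < A (u ∷ vs) → All (R t) vs → R (suc t) u) →
  (∀ t u → R (suc t) u → ∃[ v ] 0 < A (u ∷ replicateV a v) × R t v) →
  ∀ t → t ≤ K → ∀ u → 0 < Maj (powS A t) u j ⇔ R t u
support-of-powers {a = a} A j R K R-zero R-closed R-generated = go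
  where
  go : ∀ t → t ≤ K → ∀ u → 0 < Maj (powS A t) u j ⇔ R t u
  go zero    _   u = mk⇔ (λ pos → from (R-zero u) (to (maj-pow-zero A u j) pos))
                         (λ r → from (maj-pow-zero A u j) (to (R-zero u) r))
  go (suc t) t<K u = mk⇔ forward backward
    where
    IH : ∀ v → 0 < Maj (powS A t) v j ⇔ R t v
    IH = go t (<⇒≤ t<K)
    forward : 0 < Maj (powS A (suc t)) u j → R (suc t) u
    forward pos with to (maj-pow-suc A t u j) pos
    ... | vs , posA , posS = R-closed t u vs t<K posA (All.map (to (IH _)) posS)
    backward : R (suc t) u → 0 < Maj (powS A (suc t)) u j
    backward r with R-generated t u r
    ... | v , posA , rv = from (maj-pow-suc A t u j) (replicateV a v , posA , All-replicate a (from (IH v) rv))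

module Congruence (N : ℕ) where

  d : ℕ
  d = suc N

  infix 4 _≋_
  _≋_ : ℕ → ℕ → Set
  x ≋ y = x % d ≡ y % d

  ≋-+ʳ : ∀ x y z → x ≋ y → x + z ≋ y + z
  ≋-+ʳ x y z x≋y = begin
    (x + z) % d         ≡⟨ %-distribˡ-+ x z d ⟩
    (x % d + z % d) % d ≡⟨ cong (λ w → (w + z % d) % d) x≋y ⟩
    (y % d + z % d) % d ≡⟨ %-distribˡ-+ y z d ⟨
    (y + z) % d         ∎
    where open ≡-Reasoning

  ≋-suc : ∀ x y → x ≋ y → suc x ≋ suc y
  ≋-suc x y x≋y = subst₂ _≋_ (+-comm x 1) (+-comm y 1) (≋-+ʳ x y 1 x≋y)

  ≋-cancel-suc : ∀ x y → suc x ≋ suc y → x ≋ y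
  ≋-cancel-suc x y sx≋sy = begin
    x % d           ≡⟨ [m+n]%n≡m%n x d ⟨
    (x + d) % d     ≡⟨ cong (_% d) (+-suc x N) ⟩
    (suc x + N) % d ≡⟨ ≋-+ʳ (suc x) (suc y) N sx≋sy ⟩
    (suc y + N) % d ≡⟨ cong (_% d) (+-suc y N) ⟨
    (y + d) % d     ≡⟨ [m+n]%n≡m%n y d ⟩
    y % d           ∎
    where open ≡-Reasoning

  ≋-cancel-+ʳ : ∀ x y z → x + z ≋ y + z → x ≋ y
  ≋-cancel-+ʳ x y zero    h rewrite +-identityʳ x | +-identityʳ y = h
  ≋-cancel-+ʳ x y (suc z) h rewrite +-suc x z | +-suc y z = ≋-cancel-+ʳ x y z (≋-cancel-suc (x + z) (y + z) h)

  ≋-cancel-+ˡ : ∀ x y z → z + x ≋ z + y → x ≋ y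
  ≋-cancel-+ˡ x y z h rewrite +-comm z x | +-comm z y = ≋-cancel-+ʳ x y z h

  ≋-%ʳ : ∀ x y → x + y ≋ x + y % d
  ≋-%ʳ x y = begin
    (x + y) % d             ≡⟨ %-distribˡ-+ x y d ⟩
    (x % d + y % d) % d     ≡⟨ cong (λ w → (x % d + w) % d) (m%n%n≡m%n y d) ⟨
    (x % d + y % d % d) % d ≡⟨ %-distribˡ-+ x (y % d) d ⟨
    (x + y % d) % d         ∎
    where open ≡-Reasoning

  ≋-<⇒≡ : ∀ {x y} → x < d → y < d → x ≋ y → x ≡ y
  ≋-<⇒≡ x<d y<d x≋y = trans (sym (m<n⇒m%n≡m x<d)) (trans x≋y (m<n⇒m%n≡m y<d))

  ≋-≤⇒≡ : ∀ {x y} → 0 < x → x ≤ d → 0 < y → y ≤ d → x ≋ y → x ≡ y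
  ≋-≤⇒≡ {suc x} {suc y} _ (s≤s x<d) _ (s≤s y<d) x≋y = cong suc (≋-<⇒≡ (s≤s x<d) (s≤s y<d) (≋-cancel-suc x y x≋y))

  ≋0⇒≡d : ∀ {x} → 0 < x → x < d + d → x ≋ 0 → x ≡ d
  ≋0⇒≡d {x} 0<x x<2d x≋0 with x <? d
  ... | yes x<d with () ← <⇒≢ 0<x (sym (trans (sym (m<n⇒m%n≡m x<d)) x≋0))
  ... | no  x≮d = trans (sym (m∸n+n≡m d≤x)) (cong (_+ d) x∸d≡0)
    where
    d≤x : d ≤ x
    d≤x = ≮⇒≥ x≮d
    x∸d<d : x ∸ d < d
    x∸d<d = +-cancelʳ-< _ _ d (subst (_< d + d) (sym (m∸n+n≡m d≤x)) x<2d)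
    x∸d≡0 : x ∸ d ≡ 0
    x∸d≡0 = ≋-<⇒≡ x∸d<d (s≤s z≤n) (trans (sym ([m+n]%n≡m%n (x ∸ d) d)) (trans (cong (_% d) (m∸n+n≡m d≤x)) x≋0))

  residue-offset : ∀ B c → c < d → ∃[ i ] i < d × (B + i) % d ≡ c
  residue-offset zero    c c<d = c , c<d , m<n⇒m%n≡m c<d
  residue-offset (suc B) c c<d with residue-offset B c c<d
  ... | zero  , _   , B≡c = N , ≤-refl , trans (cong (_% d) (sym (+-suc B N))) (trans ([m+n]%n≡m%n B d) (trans (cong (_% d) (sym (+-identityʳ B))) B≡c))
  ... | suc i , i<d , B≡c = i , <-trans (n<1+n i) i<d , trans (cong (_% d) (sym (+-suc B i))) B≡c

  ℤ⇒≋ : ∀ a b (L : ℤ) → + a ≡ + b ℤ.+ L ℤ.* + d → a ≋ b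
  ℤ⇒≋ a b (+ l) a≡b+ld = trans (cong (_% d) a≡) ([m+kn]%n≡m%n b l d)
    where
    a≡ : a ≡ b + l * d
    a≡ = ℤP.+-injective (begin
      + a                 ≡⟨ a≡b+ld ⟩
      + b ℤ.+ + l ℤ.* + d ≡⟨ cong (λ y → + b ℤ.+ y) (ℤP.pos-* l d) ⟨
      + b ℤ.+ + (l * d)   ≡⟨ ℤP.pos-+ b (l * d) ⟨
      + (b + l * d)       ∎)
      where open ≡-Reasoning
  ℤ⇒≋ a b L@(-[1+ l ]) a≡b+ld = sym (trans (cong (_% d) b≡) ([m+kn]%n≡m%n a (suc l) d))
    where
    solve-for-b : ∀ B L D → B ≡ (B ℤ.+ L ℤ.* D) ℤ.+ (ℤ.- L) ℤ.* D
    solve-for-b = ZSolver.solve-∀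
    b≡ : b ≡ a + suc l * d
    b≡ = ℤP.+-injective (begin
      + b                             ≡⟨ solve-for-b (+ b) L (+ d) ⟩
      (+ b ℤ.+ L ℤ.* + d) ℤ.+ + suc l ℤ.* + d ≡⟨ cong (ℤ._+ + suc l ℤ.* + d) a≡b+ld ⟨
      + a ℤ.+ + suc l ℤ.* + d         ≡⟨ cong (λ y → + a ℤ.+ y) (ℤP.pos-* (suc l) d) ⟨
      + a ℤ.+ + (suc l * d)           ≡⟨ ℤP.pos-+ a (suc l * d) ⟨
      + (a + suc l * d)               ∎)
      where open ≡-Reasoning

  absN-≋ : ∀ (z : ℤ) x (K : ℤ) → z ≡ + x ℤ.+ K ℤ.* + d → absN d z ≋ x
  absN-≋ z x K z≡x+Kd = ℤ⇒≋ (absN d z) x (K ℤ.- Q) (begin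
    + suc w                                   ≡⟨ shift (+ w) Q (+ d) ⟩
    ((+ w ℤ.+ Q ℤ.* + d) ℤ.+ + 1) ℤ.- Q ℤ.* + d ≡⟨ cong (λ y → (y ℤ.+ + 1) ℤ.- Q ℤ.* + d) (ℤDM.a≡a%ℕn+[a/ℕn]*n (z ℤ.- + 1) d) ⟨
    ((z ℤ.- + 1) ℤ.+ + 1) ℤ.- Q ℤ.* + d       ≡⟨ unshift z Q (+ d) ⟩
    z ℤ.- Q ℤ.* + d                           ≡⟨ cong (ℤ._- Q ℤ.* + d) z≡x+Kd ⟩
    (+ x ℤ.+ K ℤ.* + d) ℤ.- Q ℤ.* + d         ≡⟨ regroup (+ x) K Q (+ d) ⟩
    + x ℤ.+ (K ℤ.- Q) ℤ.* + d                 ∎)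
    where
    open ≡-Reasoning
    w = (z ℤ.- + 1) %ℕ d
    Q = (z ℤ.- + 1) /ℕ d
    shift : ∀ W Q D → + 1 ℤ.+ W ≡ ((W ℤ.+ Q ℤ.* D) ℤ.+ + 1) ℤ.- Q ℤ.* D
    shift = ZSolver.solve-∀
    unshift : ∀ Z Q D → ((Z ℤ.- + 1) ℤ.+ + 1) ℤ.- Q ℤ.* D ≡ Z ℤ.- Q ℤ.* D
    unshift = ZSolver.solve-∀
    regroup : ∀ X K Q D → (X ℤ.+ K ℤ.* D) ℤ.- Q ℤ.* D ≡ X ℤ.+ (K ℤ.- Q) ℤ.* D
    regroup = ZSolver.solve-∀

  absN-range : ∀ (z : ℤ) → 0 < absN d z × absN d z ≤ d
  absN-range z = s≤s z≤n , ℤDM.n%ℕd<d (z ℤ.- + 1) d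

if-pos⇔T : ∀ b → 0 < (if b then 1 else 0) ⇔ T b
if-pos⇔T true  = mk⇔ _ (λ _ → s≤s z≤n)
if-pos⇔T false = mk⇔ (λ ()) (λ ())

≡ᵇ⇒ : ∀ {x y} → T (x ≡ᵇ y) → x ≡ y
≡ᵇ⇒ = ≡ᵇ⇒≡ _ _

⇒≡ᵇ : ∀ {x y} → x ≡ y → T (x ≡ᵇ y)
⇒≡ᵇ = ≡⇒≡ᵇ _ _

allV-replicate : ∀ {n} k (v : Fin n) → allV (λ x → ⌊ x ≟ v ⌋) (replicateV k v) ≡ true
allV-replicate zero    v = refl
allV-replicate (suc k) v with v ≟ v
... | yes _   = allV-replicate k v
... | no  v≢v = ⊥-elim (v≢v refl)

anyV-witness : ∀ {X : Set} {P : X → Set} {k} (p : X → Bool) (xs : Vec X k) →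
  All P xs → T (anyV p xs) → ∃[ x ] P x × T (p x)
anyV-witness p (x ∷ xs) (px ∷ pxs) found with p x in px≡
... | true  = x , px , subst T (sym px≡) _
... | false = anyV-witness p xs pxs found

inRange-intro : ∀ n q r s x → s < q + 2 → x ≡ absN n (+ r ℤ.- + q ℤ.+ + s) → T (inRange n q r x)
inRange-intro n q r s x s<q+2 x≡ = any⁺ _ (lose (∈-upTo⁺ s<q+2) (⇒≡ᵇ x≡))

A0-diagonal : ∀ {n} k (u v : Fin n) → A0entry u (v ∷ replicateV k v) ≡ M1 u v
A0-diagonal k u v rewrite allV-replicate k v = refl

Ak-diagonal : ∀ {n} k q r (u v : Fin n) → Akentry q r u (v ∷ replicateV k v) ≡ M1 u v
Ak-diagonal k q r u v rewrite allV-replicate k v = refl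

A0-pos⇒ : ∀ {n k} (u v : Fin n) (vs : Vec (Fin n) k) → 0 < A0entry u (v ∷ vs) → 0 < M1 u v
A0-pos⇒ u v vs pos with allV (λ x → ⌊ x ≟ v ⌋) vs
... | true  = pos
... | false with () ← pos

BridgeEntry : ∀ {n k} → ℕ → ℕ → Fin n → Vec (Fin n) k → Set
BridgeEntry {n} q r u vs =
  T (not (inRange n q r (val u))) ×
  T (anyV (λ x → val x ≡ᵇ absN n (+ r ℤ.- + q ℤ.- + 1)) vs) ×
  T (anyV (λ x → val x ≡ᵇ absN n (+ r)) vs)

Ak-pos⇒ : ∀ {n k} q r (u v : Fin n) (vs : Vec (Fin n) k) → 0 < Akentry q r u (v ∷ vs) →
  0 < M1 u v ⊎ BridgeEntry q r u (v ∷ vs)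
Ak-pos⇒ {n} q r u v vs pos with allV (λ x → ⌊ x ≟ v ⌋) vs
... | true  = inj₁ pos
... | false = inj₂ (four-tests (not (inRange n q r (val u))) (allV (λ x → (val x ≡ᵇ a) ∨ (val x ≡ᵇ b)) (v ∷ vs))
                               (anyV (λ x → val x ≡ᵇ a) (v ∷ vs)) (anyV (λ x → val x ≡ᵇ b) (v ∷ vs)) pos)
  where
  a = absN n (+ r ℤ.- + q ℤ.- + 1)
  b = absN n (+ r)
  -- of the four tests only the first, third and fourth are needed
  four-tests : ∀ w x y z → 0 < (if w ∧ x ∧ y ∧ z then 1 else 0) → T w × T y × T z
  four-tests true true true true _ = _ , _ , _
  four-tests false _     _     _     ()
  four-tests true  false _     _     ()
  four-tests true  true  false _     ()
  four-tests true  true  true  false ()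

-- The digraph D(M₁) on n = N' + 2 vertices: the cycle 1 → 2 → ⋯ → n → 1 together with
-- the shortcut n-1 → 1.  Vertex u ∈ Fin n is the paper's vertex val u.
module Wielandt (N' : ℕ) where

  N : ℕ
  N = suc N'

  open Congruence N public

  -- Arc u v means (M₁)_{uv} = 1, i.e. D(M₁) has the arc v → u.
  Arc : Fin d → Fin d → Set
  Arc u v = (val u ≡ 1 × (val v ≡ N ⊎ val v ≡ d)) ⊎ val u ≡ suc (val v)

  M1-pos⇔Arc : ∀ (u v : Fin d) → 0 < M1 u v ⇔ Arc u v
  M1-pos⇔Arc u v = mk⇔
    (Sum.map (Product.map ≡ᵇ⇒ (Sum.map ≡ᵇ⇒ ≡ᵇ⇒ ∘ to T-∨) ∘ to T-∧) ≡ᵇ⇒ ∘ to T-∨ ∘ to (if-pos⇔T _))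
    (from (if-pos⇔T _) ∘ from T-∨ ∘ Sum.map (from T-∧ ∘ Product.map ⇒≡ᵇ (from T-∨ ∘ Sum.map ⇒≡ᵇ ⇒≡ᵇ)) ⇒≡ᵇ)

  vertex-n : Fin d
  vertex-n = fromℕ N

  val-vertex-n : val vertex-n ≡ d
  val-vertex-n = cong suc (toℕ-fromℕ N)

  vertex-n-1 : Fin d
  vertex-n-1 = inject₁ (fromℕ N')

  val-vertex-n-1 : val vertex-n-1 ≡ N
  val-vertex-n-1 = cong suc (trans (toℕ-inject₁ (fromℕ N')) (toℕ-fromℕ N'))

  val-≋-injective : ∀ (u v : Fin d) → val u ≋ val v → u ≡ v
  val-≋-injective u v u≋v = toℕ-injective (suc-injective (≋-≤⇒≡ (s≤s z≤n) (toℕ<n u) (s≤s z≤n) (toℕ<n v) u≋v))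

  -- A walk of length t starting at a vertex of position J ∈ [0, N) (position n counts as 0)
  -- which takes s of the shortcuts ends at position J + t + s.  The first shortcut can be
  -- taken after N - J steps and each further one N steps later, so s shortcuts fit into
  -- t steps iff s = 0 or s·N < t + J.
  Feasible : ℕ → ℕ → ℕ → Set
  Feasible J t s = s ≡ 0 ⊎ s * N < t + J

  -- u is reachable from the start J by a walk of length t.  (That this closed form is the
  -- reachable set is what reach-zero and reach-suc⇔ below establish.)
  Reach : ℕ → ℕ → Fin d → Set
  Reach J t u = ∃[ s ] Feasible J t s × J + t + s ≋ val u

  feasible-suc : ∀ {J t s} → Feasible J t s → Feasible J (suc t) s
  feasible-suc (inj₁ s≡0) = inj₁ s≡0
  feasible-suc (inj₂ sN<) = inj₂ (m≤n⇒m≤1+n sN<)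

  feasible-≤ : ∀ {J t s s′} → s′ ≤ s → Feasible J t s → Feasible J t s′
  feasible-≤ z≤n        _           = inj₁ refl
  feasible-≤ (s≤s _)    (inj₁ ())
  feasible-≤ s′≤s       (inj₂ sN<) = inj₂ (≤-<-trans (*-monoˡ-≤ N s′≤s) sN<)

  -- Only the residue of s matters, so s can be taken below n.
  reach-normalise : ∀ J t u → Reach J t u → ∃[ s ] s < d × Feasible J t s × J + t + s ≋ val u
  reach-normalise J t u (s , feasible , ends) =
    s % d , m%n<n s d , feasible-≤ {J} {t} (m%n≤m s d) feasible , trans (sym (≋-%ʳ (J + t) s)) ends

  -- At time 0 only the start j itself is reachable (no shortcut fits: J < N).
  reach-zero : ∀ J (j u : Fin d) → J < N → J ≋ val j → Reach J 0 u ⇔ u ≡ j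
  reach-zero J j u J<N J≋j = mk⇔ reached⇒start start⇒reached
    where
    J+0+0 : J + 0 + 0 ≡ J
    J+0+0 = trans (+-identityʳ (J + 0)) (+-identityʳ J)
    reached⇒start : Reach J 0 u → u ≡ j
    reached⇒start (zero , _ , ends) = val-≋-injective u j (trans (sym ends) (trans (cong (_% d) J+0+0) J≋j))
    reached⇒start (suc s , inj₁ () , _)
    reached⇒start (suc s , inj₂ sN<J , _) = ⊥-elim (<-irrefl refl (<-≤-trans (<-≤-trans sN<J (<⇒≤ J<N)) (m≤m+n N (s * N))))
    start⇒reached : u ≡ j → Reach J 0 u
    start⇒reached refl = 0 , inj₁ refl , trans (cong (_% d) J+0+0) J≋j

  -- A walk sitting at n-1 after s shortcuts may take one more shortcut at its next step.
  next-shortcut-feasible : ∀ J t s → J + t + s ≋ N → Feasible J t s → N + s * N ≤ t + J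
  next-shortcut-feasible J t s at-n-1 feasible = +-cancelʳ-≤ s _ _ (subst₂ _≤_ (sym lhs≡) (sym rhs≡) N+sd≤X)
    where
    X = J + t + s
    w = X / d
    X≡ : X ≡ N + w * d
    X≡ = trans (m≡m%n+[m/n]*n X d) (cong (_+ w * d) (trans at-n-1 (m<n⇒m%n≡m (n<1+n N))))
    lhs≡ : N + s * N + s ≡ N + s * d
    lhs≡ = regroup N s
      where
      regroup : ∀ N s → N + s * N + s ≡ N + s * suc N
      regroup = solve-∀
    rhs≡ : t + J + s ≡ X
    rhs≡ = cong (_+ s) (+-comm t J)
    s≤w : Feasible J t s → s ≤ w
    s≤w (inj₁ refl) = z≤n
    s≤w (inj₂ sN<) with s ≤? w
    ... | yes s≤w = s≤w
    ... | no  s≰w = ⊥-elim (<-asym (subst (_< s * d) (sym X≡) (*-monoˡ-≤ d (≰⇒> s≰w)))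
                                   (subst₂ _<_ (sN+s≡sd s N) rhs≡ (+-monoˡ-< s sN<)))
      where
      sN+s≡sd : ∀ s N → s * N + s ≡ s * suc N
      sN+s≡sd = solve-∀
    N+sd≤X : N + s * d ≤ X
    N+sd≤X = subst (N + s * d ≤_) (sym X≡) (+-monoʳ-≤ N (*-monoˡ-≤ d (s≤w feasible)))

  position-suc : ∀ J t s → J + suc t + s ≡ suc (J + t + s)
  position-suc J t s = cong (_+ s) (+-suc J t)

  n+1≋1 : suc d ≋ 1
  n+1≋1 = [m+n]%n≡m%n 1 d

  reach-arc : ∀ J t u v → Reach J t v → Arc u v → Reach J (suc t) u
  reach-arc J t u v (s , feasible , ends) (inj₂ u≡v+1) =
    s , feasible-suc {J} {t} feasible , trans (cong (_% d) (position-suc J t s))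
      (trans (≋-suc (J + t + s) (val v) ends) (cong (_% d) (sym u≡v+1)))
  reach-arc J t u v (s , feasible , ends) (inj₁ (u≡1 , inj₂ v≡n)) =
    s , feasible-suc {J} {t} feasible , trans (cong (_% d) (position-suc J t s))
      (trans (≋-suc (J + t + s) (val v) ends) (trans (cong (λ x → suc x % d) v≡n) (trans n+1≋1 (cong (_% d) (sym u≡1)))))
  reach-arc J t u v (s , feasible , ends) (inj₁ (u≡1 , inj₁ v≡n-1)) =
    suc s , inj₂ (s≤s (next-shortcut-feasible J t s at-n-1 feasible)) , trans (cong (_% d) two-more)
      (trans (≋-suc (suc (J + t + s)) (suc N) (≋-suc (J + t + s) N at-n-1))
             (trans n+1≋1 (cong (_% d) (sym u≡1))))
    where
    at-n-1 : J + t + s ≋ N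
    at-n-1 = trans ends (cong (_% d) v≡n-1)
    two-more : J + suc t + suc s ≡ suc (suc (J + t + s))
    two-more = trans (position-suc J t (suc s)) (cong suc (+-suc (J + t) s))

  cycle-predecessor : ∀ x (u : Fin d) → suc x ≋ val u → ∃[ v ] Arc u v × x ≋ val v
  cycle-predecessor x fzero    sx≋1 =
    vertex-n , inj₁ (refl , inj₂ val-vertex-n) ,
    trans (≋-cancel-suc x d (trans sx≋1 (sym n+1≋1))) (cong (_% d) (sym val-vertex-n))
  cycle-predecessor x (fsuc u′) sx≋u =
    inject₁ u′ , inj₂ u≡v+1 , ≋-cancel-suc x (val (inject₁ u′)) (trans sx≋u (cong (_% d) u≡v+1))
    where
    u≡v+1 : val {d} (fsuc u′) ≡ suc (val (inject₁ u′))
    u≡v+1 = cong (suc ∘ suc) (sym (toℕ-inject₁ u′))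

  -- A walk that has just taken its (s′+1)-th shortcut at the last possible moment came
  -- from n-1 with s′ shortcuts and now sits at 1.
  shortcut-predecessor : ∀ J t s′ (u : Fin d) → suc s′ * N ≡ t + J → J + suc t + suc s′ ≋ val u →
    ∃[ v ] Arc u v × Reach J t v
  shortcut-predecessor J t s′ u last ends =
    vertex-n-1 , inj₁ (u≡1 , inj₁ val-vertex-n-1) , s′ , inj₂ s′N<t+J , at-n-1
    where
    end≡ : ∀ J t s′ N → suc s′ * N ≡ t + J → J + suc t + suc s′ ≡ 1 + suc s′ * suc N
    end≡ J t s′ N last = begin
      J + suc t + suc s′       ≡⟨ shuffle J t s′ ⟩
      suc (suc (t + J + s′))   ≡⟨ cong (λ x → suc (suc (x + s′))) last ⟨
      suc (suc (suc s′ * N + s′)) ≡⟨ expand s′ N ⟩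
      1 + suc s′ * suc N       ∎
      where
      open ≡-Reasoning
      shuffle : ∀ J t s′ → J + suc t + suc s′ ≡ suc (suc (t + J + s′))
      shuffle = solve-∀
      expand : ∀ s′ N → suc (suc (suc s′ * N + s′)) ≡ 1 + suc s′ * suc N
      expand = solve-∀
    u≡1 : val u ≡ 1
    u≡1 = cong val (val-≋-injective u fzero (trans (sym ends) (trans (cong (_% d) (end≡ J t s′ N last)) ([m+kn]%n≡m%n 1 (suc s′) d))))
    s′N<t+J : s′ * N < t + J
    s′N<t+J = subst (s′ * N <_) last (m<n+m (s′ * N) {N} (s≤s z≤n))
    position≡ : ∀ J t s′ N → suc s′ * N ≡ t + J → J + t + s′ ≡ N + s′ * suc N
    position≡ J t s′ N last = begin
      J + t + s′       ≡⟨ cong (_+ s′) (+-comm J t) ⟩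
      t + J + s′       ≡⟨ cong (_+ s′) last ⟨
      suc s′ * N + s′  ≡⟨ expand s′ N ⟩
      N + s′ * suc N   ∎
      where
      open ≡-Reasoning
      expand : ∀ s′ N → suc s′ * N + s′ ≡ N + s′ * suc N
      expand = solve-∀
    at-n-1 : J + t + s′ ≋ val vertex-n-1
    at-n-1 = trans (cong (_% d) (position≡ J t s′ N last)) (trans ([m+kn]%n≡m%n N s′ d) (cong (_% d) (sym val-vertex-n-1)))

  reach-suc⇔ : ∀ J t u → Reach J (suc t) u ⇔ (∃[ v ] Arc u v × Reach J t v)
  reach-suc⇔ J t u = mk⇔ back (λ (v , arc , reached) → reach-arc J t u v reached arc)
    where
    cycle-step-back : ∀ s → Feasible J t s → J + suc t + s ≋ val u → ∃[ v ] Arc u v × Reach J t v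
    cycle-step-back s feasible ends with cycle-predecessor (J + t + s) u (trans (cong (_% d) (sym (position-suc J t s))) ends)
    ... | v , arc , at-v = v , arc , s , feasible , at-v
    back : Reach J (suc t) u → ∃[ v ] Arc u v × Reach J t v
    back (zero , _ , ends) = cycle-step-back 0 (inj₁ refl) ends
    back (suc s′ , inj₁ () , _)
    back (suc s′ , inj₂ sN≤t+J , ends) with suc s′ * N <? t + J
    ... | yes sN<t+J = cycle-step-back (suc s′) (inj₂ sN<t+J) ends
    ... | no  sN≮t+J = shortcut-predecessor J t s′ u (≤-antisym (≤-pred sN≤t+J) (≮⇒≥ sN≮t+J)) ends

  shortcuts-bound : ∀ q r J t s → J < N → r ≤ N → suc t ≤ N * q + r → s * N < t + J → s ≤ suc q
  shortcuts-bound q r J t s J<N r≤N t<k sN<t+J with s ≤? suc q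
  ... | yes s≤q+1 = s≤q+1
  ... | no  s≰q+1 = ⊥-elim (<-irrefl refl (begin-strict
    suc q * N + N   ≡⟨ +-comm (suc q * N) N ⟩
    suc (suc q) * N ≤⟨ *-monoˡ-≤ N (≰⇒> s≰q+1) ⟩
    s * N           <⟨ sN<t+J ⟩
    t + J           <⟨ +-mono-< t<k J<N ⟩
    N * q + r + N   ≤⟨ +-monoˡ-≤ N (+-monoʳ-≤ (N * q) r≤N) ⟩
    N * q + N + N   ≡⟨ cong (_+ N) (trans (+-comm (N * q) N) (cong (λ x → N + x) (*-comm N q))) ⟩
    suc q * N + N   ∎))
    where open ≤-Reasoning

  last-shortcut-position : ∀ q r J t → J < N → r ≤ N → suc t ≤ N * q + r → suc q * N < t + J →
    ¬ (J + t + suc q ≋ r)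
  last-shortcut-position q r J t J<N r≤N t<k q+1<t+J at-r = <-irrefl D+1≡r D+1<r
    where
    D = proj₁ (m≤n⇒∃[o]m+o≡n q+1<t+J)
    t+J≡ : suc (suc q * N) + D ≡ t + J
    t+J≡ = proj₂ (m≤n⇒∃[o]m+o≡n q+1<t+J)
    -- the walk passed its last shortcut D steps ago, and the time bound forces D + 3 ≤ r
    D+3≤r : 3 + D ≤ r
    D+3≤r = +-cancelˡ-≤ (N * q + N) _ _ (begin
      N * q + N + (3 + D)             ≡⟨ regroup q N D ⟩
      suc (suc (suc (suc q * N) + D)) ≡⟨ cong (suc ∘ suc) t+J≡ ⟩
      suc (suc (t + J))               ≡⟨ cong suc (+-suc t J) ⟨
      suc t + suc J                   ≤⟨ +-mono-≤ t<k J<N ⟩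
      N * q + r + N                   ≡⟨ swap q N r ⟩
      N * q + N + r                   ∎)
      where
      open ≤-Reasoning
      regroup : ∀ q N D → N * q + N + (3 + D) ≡ suc (suc (suc (suc q * N) + D))
      regroup = solve-∀
      swap : ∀ q N r → N * q + r + N ≡ N * q + N + r
      swap = solve-∀
    D+1<r : suc D < r
    D+1<r = ≤-trans (n≤1+n _) D+3≤r
    -- but the walk ends at position D + 1 (mod n)
    end≡ : J + t + suc q ≡ suc D + suc q * d
    end≡ = begin
      J + t + suc q                 ≡⟨ cong (_+ suc q) (+-comm J t) ⟩
      t + J + suc q                 ≡⟨ cong (_+ suc q) t+J≡ ⟨
      suc (suc q * N) + D + suc q   ≡⟨ regroup q N D ⟩
      suc D + suc q * suc N         ∎
      where
      open ≡-Reasoning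
      regroup : ∀ q N D → suc (suc q * N) + D + suc q ≡ suc D + suc q * suc N
      regroup = solve-∀
    D+1≡r : suc D ≡ r
    D+1≡r = ≋-<⇒≡ (m≤n⇒m≤1+n (≤-trans D+1<r r≤N)) (s≤s r≤N)
                  (trans (sym ([m+kn]%n≡m%n (suc D) (suc q) d)) (trans (cong (_% d) (sym end≡)) at-r))

-- Here n = q + e + 3, so that
-- |r-q-1|_n ≡ r + e + 2 and the excluded range {|r-q|_n, …, |r+1|_n} consists of the
-- classes r + s + e + 3 with s ≤ q + 1.
module Bridge (q e : ℕ) where

  open Wielandt (suc (q + e)) public

  n≡ : d ≡ (e + 2) + suc q
  n≡ = regroup q e
    where
    regroup : ∀ q e → suc (suc (suc (q + e))) ≡ (e + 2) + suc q
    regroup = solve-∀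

  -- Two walks of length t ending at r + e + 2 and at r: if the second uses δ fewer shortcuts
  -- then δ ≡ e + 2, and if it uses δ more then δ ≡ q + 1 (mod n); for δ < n these are equalities.
  shortcut-gap : ∀ J t r s δ → J + t + (s + δ) ≋ r + e + 2 → J + t + s ≋ r → r + δ ≋ r + (e + 2)
  shortcut-gap J t r s δ ends₁ ends₂ = begin
    (r + δ) % d           ≡⟨ ≋-+ʳ (J + t + s) r δ ends₂ ⟨
    (J + t + s + δ) % d   ≡⟨ cong (_% d) (+-assoc (J + t) s δ) ⟩
    (J + t + (s + δ)) % d ≡⟨ ends₁ ⟩
    (r + e + 2) % d       ≡⟨ cong (_% d) (+-assoc r e 2) ⟩
    (r + (e + 2)) % d     ∎
    where open ≡-Reasoning

  gap-ordered : ∀ J t r s δ → δ < d → J + t + (s + δ) ≋ r + e + 2 → J + t + s ≋ r → δ ≡ e + 2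
  gap-ordered J t r s δ δ<d ends₁ ends₂ =
    ≋-<⇒≡ δ<d (subst (e + 2 <_) (sym n≡) (m<m+n (e + 2) {suc q} (s≤s z≤n)))
      (≋-cancel-+ˡ δ (e + 2) r (shortcut-gap J t r s δ ends₁ ends₂))

  gap-crossed : ∀ J t r s δ → suc δ < d → J + t + s ≋ r + e + 2 → J + t + (s + suc δ) ≋ r → suc δ ≡ suc q
  gap-crossed J t r s δ δ<d ends₁ ends₂ = +-cancelˡ-≡ (e + 2) (suc δ) (suc q) (trans full-turn n≡)
    where
    turn : r + (e + 2 + suc δ) ≋ r + 0
    turn = begin
      (r + (e + 2 + suc δ)) % d   ≡⟨ cong (_% d) (regroup r e (suc δ)) ⟩
      (r + e + 2 + suc δ) % d     ≡⟨ ≋-+ʳ (J + t + s) (r + e + 2) (suc δ) ends₁ ⟨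
      (J + t + s + suc δ) % d     ≡⟨ cong (_% d) (+-assoc (J + t) s (suc δ)) ⟩
      (J + t + (s + suc δ)) % d   ≡⟨ ends₂ ⟩
      r % d                       ≡⟨ cong (_% d) (+-identityʳ r) ⟨
      (r + 0) % d                 ∎
      where
      open ≡-Reasoning
      regroup : ∀ r e δ → r + (e + 2 + δ) ≡ r + e + 2 + δ
      regroup = solve-∀
    full-turn : e + 2 + suc δ ≡ d
    full-turn = ≋0⇒≡d (subst (0 <_) (sym (+-suc (e + 2) δ)) (s≤s z≤n))
                      (+-mono-< (subst (e + 2 <_) (sym n≡) (m<m+n (e + 2) {suc q} (s≤s z≤n))) δ<d)
                      (≋-cancel-+ˡ (e + 2 + suc δ) 0 r turn)

  -- Ordered case: the stretched walks end at every class r + 1 + i with i ≤ e + 2; all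
  -- other classes lie in the excluded range.
  cover : ∀ J t r (u : Fin d) s → Feasible J t (s + (e + 2)) → J + t + s ≋ r →
    (∀ σ → σ ≤ suc q → ¬ (val u ≋ r + σ + e + 3)) → Reach J (suc t) u
  cover J t r u s feasible ends u-allowed with residue-offset (J + suc t + s) (val u % d) (m%n<n (val u) d)
  ... | i , i<d , ends-at-u with i ≤? e + 2
  ...   | yes i≤e+2 = s + i , feasible-suc {J} {t} (feasible-≤ {J} {t} (+-monoʳ-≤ s i≤e+2) feasible) ,
                      trans (cong (_% d) (sym (+-assoc (J + suc t) s i))) ends-at-u
  ...   | no  i≰e+2 = ⊥-elim (u-allowed (suc σ) (m≤n⇒m≤1+n σ<q) u≋)
    where
    σ = proj₁ (m≤n⇒∃[o]m+o≡n (≰⇒> i≰e+2))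
    i≡ : suc (e + 2) + σ ≡ i
    i≡ = proj₂ (m≤n⇒∃[o]m+o≡n (≰⇒> i≰e+2))
    σ<q : suc σ ≤ q
    σ<q = +-cancelˡ-< (suc (e + 2)) σ q (subst₂ _<_ (sym i≡) (trans n≡ (regroup q e)) i<d)
      where
      regroup : ∀ q e → (e + 2) + suc q ≡ suc (e + 2) + q
      regroup = solve-∀
    one-more : J + suc t + s ≋ suc r
    one-more = trans (cong (_% d) (position-suc J t s)) (≋-suc (J + t + s) r ends)
    u≋ : val u ≋ r + suc σ + e + 3
    u≋ = trans (sym ends-at-u) (trans (≋-+ʳ (J + suc t + s) (suc r) i one-more)
           (cong (_% d) (trans (cong (λ x → suc r + x) (sym i≡)) (regroup r e σ))))
      where
      regroup : ∀ r e σ → suc r + (suc (e + 2) + σ) ≡ r + suc σ + e + 3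
      regroup = solve-∀

  -- Crossed case: a walk ending at r with q + 1 more shortcuts than another walk is too long.
  too-many-shortcuts : ∀ J t r s → J < N → r ≤ N → suc t ≤ N * q + r →
    Feasible J t (s + suc q) → ¬ (J + t + (s + suc q) ≋ r)
  too-many-shortcuts J t r zero    J<N r≤N t<k (inj₂ q+1<t+J) = last-shortcut-position q r J t J<N r≤N t<k q+1<t+J
  too-many-shortcuts J t r (suc s) J<N r≤N t<k (inj₂ sN<t+J) _ =
    1+n≰n (≤-trans (s≤s (m≤n+m (suc q) s)) (shortcuts-bound q r J t (suc s + suc q) J<N r≤N t<k sN<t+J))

  bridge : ∀ J t r (u x y : Fin d) → J < N → r ≤ N → suc t ≤ N * q + r →
    Reach J t x → Reach J t y → val x ≋ r + e + 2 → val y ≋ r →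
    (∀ σ → σ ≤ suc q → ¬ (val u ≋ r + σ + e + 3)) → Reach J (suc t) u
  bridge J t r u x y J<N r≤N t<k reach-x reach-y x≋ y≋ u-allowed
    with reach-normalise J t x reach-x | reach-normalise J t y reach-y
  ... | s₁ , s₁<d , feasible₁ , ends₁ | s₂ , s₂<d , feasible₂ , ends₂ with s₂ ≤? s₁
  ...   | yes s₂≤s₁ = cover J t r u s₂ (subst (Feasible J t) (sym s₂+gap≡s₁) feasible₁) (trans ends₂ y≋) u-allowed
    where
    δ = proj₁ (m≤n⇒∃[o]m+o≡n s₂≤s₁)
    s₂+δ≡s₁ : s₂ + δ ≡ s₁
    s₂+δ≡s₁ = proj₂ (m≤n⇒∃[o]m+o≡n s₂≤s₁)
    s₂+gap≡s₁ : s₂ + (e + 2) ≡ s₁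
    s₂+gap≡s₁ = trans (cong (λ x → s₂ + x) (sym (gap-ordered J t r s₂ δ (≤-<-trans (m≤n+m δ s₂) (subst (_< d) (sym s₂+δ≡s₁) s₁<d))
                  (subst (λ s → J + t + s ≋ r + e + 2) (sym s₂+δ≡s₁) (trans ends₁ x≋)) (trans ends₂ y≋)))) s₂+δ≡s₁
  ...   | no  s₂≰s₁ = ⊥-elim (too-many-shortcuts J t r s₁ J<N r≤N t<k
                        (subst (Feasible J t) (sym s₁+q+1≡s₂) feasible₂)
                        (subst (λ s → J + t + s ≋ r) (sym s₁+q+1≡s₂) (trans ends₂ y≋)))
    where
    δ = proj₁ (m≤n⇒∃[o]m+o≡n (≰⇒> s₂≰s₁))
    s₁+δ+1≡s₂ : s₁ + suc δ ≡ s₂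
    s₁+δ+1≡s₂ = trans (+-suc s₁ δ) (proj₂ (m≤n⇒∃[o]m+o≡n (≰⇒> s₂≰s₁)))
    s₁+q+1≡s₂ : s₁ + suc q ≡ s₂
    s₁+q+1≡s₂ = trans (cong (λ x → s₁ + x) (sym (gap-crossed J t r s₁ δ
                  (≤-<-trans (m≤n+m (suc δ) s₁) (subst (_< d) (sym s₁+δ+1≡s₂) s₂<d))
                  (trans ends₁ x≋) (subst (λ s → J + t + s ≋ r) (sym s₁+δ+1≡s₂) (trans ends₂ y≋))))) s₁+δ+1≡s₂

module Supports (q e : ℕ) where

  open Bridge q e public

  pos-+³ : ∀ x y c → + (x + y + c) ≡ + x ℤ.+ + y ℤ.+ + c
  pos-+³ x y c = trans (ℤP.pos-+ (x + y) c) (cong (ℤ._+ + c) (ℤP.pos-+ x y))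

  n-in-ℤ : + d ≡ + q ℤ.+ + e ℤ.+ + 3
  n-in-ℤ = trans (cong +_ (+-comm 3 (q + e))) (pos-+³ q e 3)

  class-before : ∀ r → absN d (+ r ℤ.- + q ℤ.- + 1) ≋ r + e + 2
  class-before r = absN-≋ _ (r + e + 2) (ℤ.- + 1) (begin
    + r ℤ.- + q ℤ.- + 1                                       ≡⟨ shift (+ r) (+ q) (+ e) ⟩
    (+ r ℤ.+ + e ℤ.+ + 2) ℤ.+ (ℤ.- + 1) ℤ.* (+ q ℤ.+ + e ℤ.+ + 3) ≡⟨ cong₂ (λ x y → x ℤ.+ (ℤ.- + 1) ℤ.* y) (pos-+³ r e 2) n-in-ℤ ⟨
    + (r + e + 2) ℤ.+ (ℤ.- + 1) ℤ.* + d                        ∎)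
    where
    open ≡-Reasoning
    shift : ∀ R Q E → R ℤ.- Q ℤ.- + 1 ≡ (R ℤ.+ E ℤ.+ + 2) ℤ.+ (ℤ.- + 1) ℤ.* (Q ℤ.+ E ℤ.+ + 3)
    shift = ZSolver.solve-∀

  class-at : ∀ r → absN d (+ r) ≋ r
  class-at r = absN-≋ (+ r) r (+ 0) (shift (+ r) (+ d))
    where
    shift : ∀ R D → R ≡ R ℤ.+ + 0 ℤ.* D
    shift = ZSolver.solve-∀

  class-range : ∀ r σ → absN d (+ r ℤ.- + q ℤ.+ + σ) ≋ r + σ + e + 3
  class-range r σ = absN-≋ _ (r + σ + e + 3) (ℤ.- + 1) (begin
    + r ℤ.- + q ℤ.+ + σ                                                  ≡⟨ shift (+ r) (+ q) (+ e) (+ σ) ⟩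
    (+ r ℤ.+ + σ ℤ.+ + e ℤ.+ + 3) ℤ.+ (ℤ.- + 1) ℤ.* (+ q ℤ.+ + e ℤ.+ + 3) ≡⟨ cong₂ (λ x y → x ℤ.+ (ℤ.- + 1) ℤ.* y) r+σ+e+3 n-in-ℤ ⟨
    + (r + σ + e + 3) ℤ.+ (ℤ.- + 1) ℤ.* + d                                ∎)
    where
    open ≡-Reasoning
    shift : ∀ R Q E S → R ℤ.- Q ℤ.+ S ≡ (R ℤ.+ S ℤ.+ E ℤ.+ + 3) ℤ.+ (ℤ.- + 1) ℤ.* (Q ℤ.+ E ℤ.+ + 3)
    shift = ZSolver.solve-∀
    r+σ+e+3 : + (r + σ + e + 3) ≡ + r ℤ.+ + σ ℤ.+ + e ℤ.+ + 3
    r+σ+e+3 = trans (pos-+³ (r + σ) e 3) (cong (λ x → x ℤ.+ + e ℤ.+ + 3) (ℤP.pos-+ r σ))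

  outside-range : ∀ r (u : Fin d) → T (not (inRange d q r (val u))) → ∀ σ → σ ≤ suc q → ¬ (val u ≋ r + σ + e + 3)
  outside-range r u outside σ σ≤q+1 u≋ = subst T (to T-not-≡ outside) (inRange-intro d q r σ (val u) σ<q+2 val-u≡)
    where
    σ<q+2 : σ < q + 2
    σ<q+2 = subst (σ <_) (+-comm 2 q) (s≤s σ≤q+1)
    z : ℤ
    z = + r ℤ.- + q ℤ.+ + σ
    val-u≡ : val u ≡ absN d z
    val-u≡ = ≋-≤⇒≡ (s≤s z≤n) (toℕ<n u) (proj₁ (absN-range z)) (proj₂ (absN-range z))
               (trans u≋ (sym (class-range r σ)))

  reach-generated : ∀ a′ (A : Tensor d (suc (suc a′))) → (∀ u v → A (u ∷ v ∷ replicateV a′ v) ≡ M1 u v) →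
    ∀ J t u → Reach J (suc t) u → ∃[ v ] 0 < A (u ∷ replicateV (suc a′) v) × Reach J t v
  reach-generated a′ A diagonal J t u reach-u with to (reach-suc⇔ J t u) reach-u
  ... | v , arc , reach-v = v , subst (0 <_) (sym (diagonal u v)) (from (M1-pos⇔Arc u v) arc) , reach-v

  S₀⇔Reach : ∀ a′ J (j : Fin d) → J < N → J ≋ val j → ∀ t u →
    InS t (A0 d (suc (suc a′))) j u ⇔ Reach J t u
  S₀⇔Reach a′ J j J<N J≋j t =
    support-of-powers A j (Reach J) t (λ u → reach-zero J j u J<N J≋j) closed
      (reach-generated a′ A (A0-diagonal a′) J) t ≤-refl
    where
    A = A0 d (suc (suc a′))
    closed : ∀ t′ u vs → t′ < t → 0 < A (u ∷ vs) → All (Reach J t′) vs → Reach J (suc t′) u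
    closed t′ u (v ∷ vs) _ pos (reach-v ∷ _) = reach-arc J t′ u v reach-v (to (M1-pos⇔Arc u v) (A0-pos⇒ u v vs pos))

  -- Up to time k = N·q + r the extra entries of 𝔸_k create nothing new, by the bridge lemma.
  Sₖ⇔Reach : ∀ a′ r J (j : Fin d) → r ≤ N → J < N → J ≋ val j → ∀ t → t ≤ N * q + r → ∀ u →
    InS t (Ak d (suc (suc a′)) q r) j u ⇔ Reach J t u
  Sₖ⇔Reach a′ r J j r≤N J<N J≋j t t≤k =
    support-of-powers A j (Reach J) t (λ u → reach-zero J j u J<N J≋j) closed
      (reach-generated a′ A (Ak-diagonal a′ q r) J) t ≤-refl
    where
    A = Ak d (suc (suc a′)) q r
    a b : ℕ
    a = absN d (+ r ℤ.- + q ℤ.- + 1)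
    b = absN d (+ r)
    closed : ∀ t′ u vs → t′ < t → 0 < A (u ∷ vs) → All (Reach J t′) vs → Reach J (suc t′) u
    closed t′ u (v ∷ vs) t′<t pos reach-vs with Ak-pos⇒ q r u v vs pos
    ... | inj₁ M1-pos = reach-arc J t′ u v (All.head reach-vs) (to (M1-pos⇔Arc u v) M1-pos)
    ... | inj₂ (outside , has-a , has-b)
      with anyV-witness (λ x → val x ≡ᵇ a) (v ∷ vs) reach-vs has-a
         | anyV-witness (λ x → val x ≡ᵇ b) (v ∷ vs) reach-vs has-b
    ...   | x , reach-x , x-is-a | y , reach-y , y-is-b =
      bridge J t′ r u x y J<N r≤N (≤-trans t′<t t≤k) reach-x reach-y
        (trans (cong (_% d) (≡ᵇ⇒≡ (val x) a x-is-a)) (class-before r)) (trans (cong (_% d) (≡ᵇ⇒≡ (val y) b y-is-b)) (class-at r))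
        (outside-range r u outside)

  -- The start j ≠ n-1 has a position J < N: J = val j if val j ≤ n - 2, and J = 0 if j = n.
  start-position : (j : Fin d) → toℕ j + 1 ≤ suc (q + e) ⊎ toℕ j + 1 ≡ d → ∃[ J ] J < N × J ≋ val j
  start-position j (inj₁ j+1≤n-2) = val j , s≤s (subst (_≤ suc (q + e)) (+-comm (toℕ j) 1) j+1≤n-2) , refl
  start-position j (inj₂ j+1≡n)   = 0 , s≤s z≤n , sym (trans (cong (_% d) (trans (+-comm 1 (toℕ j)) j+1≡n)) (n%n≡0 d))

  Sₖ⇔S₀ : ∀ a′ r t (j u : Fin d) → r ≤ N → t ≤ N * q + r → toℕ j + 1 ≤ suc (q + e) ⊎ toℕ j + 1 ≡ d →
    InS t (Ak d (suc (suc a′)) q r) j u ⇔ InS t (A0 d (suc (suc a′))) j u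
  Sₖ⇔S₀ a′ r t j u r≤N t≤k j-allowed with start-position j j-allowed
  ... | J , J<N , J≋j = ⇔-sym (S₀⇔Reach a′ J j J<N J≋j t u) ⇔-∘ Sₖ⇔Reach a′ r J j r≤N J<N J≋j t t≤k u

-- k ≤ n² - 3n + 2 = (n-1)(n-2) together with k = (n-1)q + r, r ≥ 1 force n = q + e + 3.
room-for-q : ∀ N″ q r k → k ≤ suc (suc N″) * suc (suc N″) + 2 ∸ 3 * suc (suc N″) →
  k ≡ suc N″ * q + r → 1 ≤ r → ∃[ e ] N″ ≡ suc (q + e)
room-for-q N″ q r k k≤bound k≡ 1≤r = proj₁ q+1+e≡N″ , sym (proj₂ q+1+e≡N″)
  where
  bound≡ : suc (suc N″) * suc (suc N″) + 2 ∸ 3 * suc (suc N″) ≡ suc N″ * N″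
  bound≡ = trans (cong (_∸ 3 * suc (suc N″)) (expand N″)) (m+n∸n≡m (suc N″ * N″) (3 * suc (suc N″)))
    where
    expand : ∀ N″ → suc (suc N″) * suc (suc N″) + 2 ≡ suc N″ * N″ + 3 * suc (suc N″)
    expand = solve-∀
  q<N″ : q < N″
  q<N″ = *-cancelˡ-< (suc N″) q N″ (begin-strict
    suc N″ * q       <⟨ m<m+n (suc N″ * q) 1≤r ⟩
    suc N″ * q + r   ≡⟨ k≡ ⟨
    k                ≤⟨ k≤bound ⟩
    suc (suc N″) * suc (suc N″) + 2 ∸ 3 * suc (suc N″) ≡⟨ bound≡ ⟩
    suc N″ * N″      ∎)
    where open ≤-Reasoning
  q+1+e≡N″ : ∃[ e ] suc q + e ≡ N″
  q+1+e≡N″ = m≤n⇒∃[o]m+o≡n q<N″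

-- The proposition: write m = a′ + 2 and n = q + e + 3 and apply Sₖ⇔S₀.
proposition3p2 : (m n k q r : ℕ) → 2 ≤ m → 2 ≤ n
    → 1 ≤ k → k ≤ n * n + 2 ∸ 3 * n
    → k ≡ (n ∸ 1) * q + r → 1 ≤ r → r ≤ n ∸ 1
    → (t : ℕ) → 1 ≤ t → t ≤ k
    → (j : Fin n) → (toℕ j + 1 ≤ n ∸ 2 ⊎ toℕ j + 1 ≡ n)
    → (u : Fin n) → (InS t (Ak n m q r) j u ⇔ InS t (A0 n m) j u)
proposition3p2 (suc (suc a′)) (suc (suc N″)) k q r (s≤s (s≤s z≤n)) (s≤s (s≤s z≤n)) _ k≤bound k≡ 1≤r r≤n-1 t _ t≤k j j-allowed u
  with room-for-q N″ q r k k≤bound k≡ 1≤r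
... | e , refl = Supports.Sₖ⇔S₀ q e a′ r t j u r≤n-1 (subst (t ≤_) k≡ t≤k) j-allowed
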